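{- Let $H$ be a graph with vertex set $\{v_1,\ldots,v_h\}$, and let $\varepsilon_1,\ldots,\varepsilon_{h-1},\delta_1,\ldots,\delta_{h-1}\in(0,1)$. Let $G$ be a graph and let $D_1,\ldots,D_h$ be disjoint nonempty subsets of $V(G)$ such that for all indices $i,j$ with $1\le i<j\le h$, there do not exist $A\subset D_i$ and $B\subset D_j$ with $|A|\ge \prod_{t=j}^{h-1}\varepsilon_t\cdot |D_i|$ and $|B|\ge \frac{\delta_{j-1}}{j-1}\prod_{t=j}^{h-1}\varepsilon_t\cdot|D_j|$ such that $B$ is $\varepsilon_{j-1}$-sparse to $A$ if $v_iv_j\in E(H)$ and $B$ is $\varepsilon_{j-1}$-dense to $A$ if $v_iv_j\notin E(H)$. (Empty products equal $1$.) Then there are at least $\prod_{t=1}^{h-1}(1-\delta_t)\varepsilon_t^{t}\cdot\prod_{i=1}^h|D_i|$ copies $\varphi$ of $H$ in $G$ with $\varphi(v_i)\in D_i$ for all $i\in\{1,\ldots,h\}$.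
   Context: Graphs are finite and simple. A copy of $H$ in $G$ is a graph isomorphism $\varphi$ from $H$ to $G[S]$ for some $S\subset V(G)$. For $\varepsilon>0$ and disjoint $A,B\subset V(G)$: $B$ is $\varepsilon$-sparse to $A$ in $G$ if every vertex of $B$ is adjacent to fewer than $\varepsilon|A|$ vertices of $A$; $B$ is $\varepsilon$-dense to $A$ in $G$ if every vertex of $B$ is nonadjacent to fewer than $\varepsilon|A|$ vertices of $A$ (i.e. $B$ is $\varepsilon$-sparse to $A$ in the complement $\overline{G}$).
   Formalization: The parameters $\varepsilon_1,\ldots,\varepsilon_{h-1},\delta_1,\ldots,\delta_{h-1}$ take rational values in (0,1). -}

module Defs where

open import Data.Nat as ℕ using (ℕ; zero; suc)
open import Data.Integer using (+_)
open import Data.Rational using (ℚ; _/_; _*_; _-_; _<_; _≤_; 0ℚ; 1ℚ)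
open import Data.Bool using (Bool; true; false; not; _∧_)
open import Data.Fin using (Fin; toℕ)
open import Data.Fin.Subset using (Subset; ∣_∣; _∩_; _∈_)
open import Data.Vec using (Vec; tabulate; lookup)
open import Data.List using (List; map; foldr; length)
open import Data.Product using (_×_)
open import Relation.Binary.PropositionalEquality using (_≡_)
open import Relation.Nullary.Decidable using (⌊_⌋)
open import Data.Fin using (_≟_)

ℕ→ℚ : ℕ → ℚ
ℕ→ℚ n = (+ n) / 1

_^ℚ_ : ℚ → ℕ → ℚ
q ^ℚ zero = 1ℚ
q ^ℚ suc k = q * (q ^ℚ k)

-- ∏_{t=a}^{b-1} f t  (empty product = 1 when b ≤ a)
prodFromTo : (ℕ → ℚ) → ℕ → ℕ → ℚ
prodFromTo f a b = foldr _*_ 1ℚ (map (λ k → f (a ℕ.+ k)) (Data.List.upTo (b ℕ.∸ a)))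

prodFin : (h : ℕ) → (Fin h → ℚ) → ℚ
prodFin h f = foldr _*_ 1ℚ (Data.Vec.toList (tabulate f))

record Graph (n : ℕ) : Set where
  field
    adj    : Fin n → Fin n → Bool
    sym    : ∀ x y → adj x y ≡ adj y x
    irrefl : ∀ x → adj x x ≡ false
open Graph public

compl : ∀ {n} → Graph n → Graph n
compl {n} G = record { adj = λ x y → not (adj G x y) ∧ not ⌊ x ≟ y ⌋ ; sym = sy ; irrefl = ir }
  where
  open import Relation.Binary.PropositionalEquality using (refl; cong₂; cong)
  open import Relation.Nullary.Decidable using (yes; no)
  sy : ∀ x y → (not (adj G x y) ∧ not ⌊ x ≟ y ⌋) ≡ (not (adj G y x) ∧ not ⌊ y ≟ x ⌋)
  sy x y with x ≟ y | y ≟ x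
  ... | yes _ | yes _ = cong₂ _∧_ (cong not (Graph.sym G x y)) refl
  ... | yes refl | no q with () ← q refl
  ... | no p | yes refl with () ← p refl
  ... | no _ | no _ = cong₂ _∧_ (cong not (Graph.sym G x y)) refl
  ir : ∀ x → (not (adj G x x) ∧ not ⌊ x ≟ x ⌋) ≡ false
  ir x with x ≟ x
  ... | yes _ = Data.Bool.Properties.∧-zeroʳ _
    where import Data.Bool.Properties
  ... | no p with () ← p refl

nbhd : ∀ {n} → Graph n → Fin n → Subset n
nbhd G v = tabulate (adj G v)

Sparse : ∀ {n} → Graph n → ℚ → Subset n → Subset n → Set
Sparse G ε A B = ∀ b → b ∈ B → ℕ→ℚ ∣ A ∩ nbhd G b ∣ < ε * ℕ→ℚ ∣ A ∣

Dense : ∀ {n} → Graph n → ℚ → Subset n → Subset n → Set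
Dense G ε A B = Sparse (compl G) ε A B

IsCopy : ∀ {h n} → Graph h → Graph n → Vec (Fin n) h → Set
IsCopy H G φ = (∀ i j → lookup φ i ≡ lookup φ j → i ≡ j)
             × (∀ i j → adj G (lookup φ i) (lookup φ j) ≡ adj H i j)

{-# OPTIONS --safe #-}
-- Induction on h, removing the last part. Call a vertex x of D_h good if for every i < h its
-- link in D_i (the neighbours of x if v_i v_h ∈ E(H), the non-neighbours otherwise) has at least
-- ε_{h-1}|D_i| vertices. The vertices failing this for a fixed i form a set B that is
-- ε_{h-1}-sparse (or dense) to A = D_i, so the hypothesis for (i, h) gives (h-1)|B| < δ_{h-1}|D_h|;
-- summing over i, at least (1 - δ_{h-1})|D_h| vertices are good. The links of a good vertex satisfy
-- the hypothesis again with one factor ε_{h-1} fewer, so by induction they carry at least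
-- ∏_{1≤t≤h-2} (1 - δ_t) ε_t^t · ε_{h-1}^{h-1} ∏_{i<h} |D_i| copies of H - v_h, each of which
-- extends by x to a copy of H.
module Submission where

open import Defs
open import Data.Nat using (ℕ; zero; suc; z≤n; s≤s)
import Data.Nat as ℕ
import Data.Nat.Properties as ℕP
import Data.Nat.Coprimality as Coprimality
open import Data.Integer as ℤ using (+_)
import Data.Integer.Properties as ℤP
open import Data.Rational using (ℚ; mkℚ; _*_; _+_; _-_; -_; _<_; _≤_; 0ℚ; 1ℚ; *≤*)
open import Data.Rational.Base using (nonNegative; positive)
import Data.Rational.Properties as ℚP
open import Data.Rational.Solver using (module +-*-Solver)
open import Data.Bool using (Bool; true; false; if_then_else_)
open import Data.Empty using (⊥-elim)
open import Data.Sum as Sum using (_⊎_; inj₁; inj₂)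
open import Data.Product as Product using (_×_; _,_; proj₁; proj₂; ∃-syntax; Σ-syntax)
open import Data.Fin as Fin using (Fin; toℕ; inject₁; fromℕ)
import Data.Fin.Properties as FinP
open import Data.Fin.Subset using (Subset; ∣_∣; _∩_; _∪_; _∈_; _⊆_; Nonempty; Empty; ⋃; inside; outside)
import Data.Fin.Subset.Properties as SubsetP
open import Data.Vec as Vec using (Vec; lookup)
import Data.Vec.Properties as VecP
open import Data.List as List using (List; []; _∷_; foldr; map; upTo; _∷ʳ_; concat; length; _++_)
import Data.List.Properties as ListP
open import Data.List.Relation.Unary.All as All using (All)
import Data.List.Relation.Unary.All.Properties as AllP
import Data.List.Relation.Unary.AllPairs as AllPairs
import Data.List.Relation.Unary.AllPairs.Properties as AllPairsP
open import Data.List.Relation.Unary.Unique.Propositional using (Unique)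
import Data.List.Relation.Unary.Unique.Propositional.Properties as UniqueP
open import Data.List.Relation.Binary.Disjoint.Propositional using (Disjoint)
open import Function using (_∘_)
open import Relation.Binary.PropositionalEquality as ≡
  using (_≡_; _≢_; refl; trans; cong; cong₂; subst; subst₂; module ≡-Reasoning)
open import Relation.Nullary using (¬_; Dec; yes; no)
open import Relation.Nullary.Decidable using (does; dec-true; _×-dec_; ¬?)
open import Relation.Unary using (Decidable)

open import Algebra.Properties.Monoid.Sum ℕP.+-0-monoid using (sum)

ℕ→ℚ-normal : ∀ n → ℕ→ℚ n ≡ mkℚ (+ n) 0 (Coprimality.sym (Coprimality.1-coprimeTo n))
ℕ→ℚ-normal n = ℚP.normalize-coprime (Coprimality.sym (Coprimality.1-coprimeTo n))

ℕ→ℚ-+ : ∀ m n → ℕ→ℚ (m ℕ.+ n) ≡ ℕ→ℚ m + ℕ→ℚ n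
ℕ→ℚ-+ m n rewrite ℕ→ℚ-normal m | ℕ→ℚ-normal n =
  ℚP./-cong (≡.sym (cong₂ ℤ._+_ (ℤP.*-identityʳ (+ m)) (ℤP.*-identityʳ (+ n)))) refl

ℕ→ℚ-mono-≤ : ∀ {m n} → m ℕ.≤ n → ℕ→ℚ m ≤ ℕ→ℚ n
ℕ→ℚ-mono-≤ {m} {n} m≤n rewrite ℕ→ℚ-normal m | ℕ→ℚ-normal n =
  *≤* (subst₂ ℤ._≤_ (≡.sym (ℤP.*-identityʳ (+ m))) (≡.sym (ℤP.*-identityʳ (+ n))) (ℤ.+≤+ m≤n))

ℕ→ℚ-nonNeg : ∀ n → 0ℚ ≤ ℕ→ℚ n
ℕ→ℚ-nonNeg n = ℕ→ℚ-mono-≤ {0} {n} z≤n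

ℕ→ℚ-pos⇒pos : ∀ m → 0ℚ < ℕ→ℚ m → 0 ℕ.< m
ℕ→ℚ-pos⇒pos zero    0<0 = ⊥-elim (ℚP.<-irrefl refl 0<0)
ℕ→ℚ-pos⇒pos (suc m) _   = s≤s z≤n

ℕ→ℚ-pos : ∀ {m} → 0 ℕ.< m → 0ℚ < ℕ→ℚ m
ℕ→ℚ-pos {m} 0<m = ℚP.<-≤-trans (ℚP.positive⁻¹ 1ℚ) (ℕ→ℚ-mono-≤ {1} {m} 0<m)

*-monoˡ-≤′ : ∀ {r p q} → 0ℚ ≤ r → p ≤ q → r * p ≤ r * q
*-monoˡ-≤′ {r} 0≤r = ℚP.*-monoˡ-≤-nonNeg r {{nonNegative 0≤r}}

*-monoʳ-≤′ : ∀ {r p q} → 0ℚ ≤ r → p ≤ q → p * r ≤ q * r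
*-monoʳ-≤′ {r} 0≤r = ℚP.*-monoʳ-≤-nonNeg r {{nonNegative 0≤r}}

*-nonNeg : ∀ {p q} → 0ℚ ≤ p → 0ℚ ≤ q → 0ℚ ≤ p * q
*-nonNeg {p} 0≤p 0≤q = subst (_≤ p * _) (ℚP.*-zeroʳ p) (*-monoˡ-≤′ 0≤p 0≤q)

*-pos : ∀ {p q} → 0ℚ < p → 0ℚ < q → 0ℚ < p * q
*-pos {p} 0<p 0<q = subst (_< p * _) (ℚP.*-zeroʳ p) (ℚP.*-monoʳ-<-pos p {{positive 0<p}} 0<q)

1-p-nonNeg : ∀ {p} → p < 1ℚ → 0ℚ ≤ 1ℚ - p
1-p-nonNeg {p} p<1 = subst (_≤ 1ℚ - p) (ℚP.+-inverseʳ p) (ℚP.+-monoˡ-≤ (- p) (ℚP.<⇒≤ p<1))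

^ℚ-nonNeg : ∀ {q} k → (1 ℕ.≤ k → 0ℚ ≤ q) → 0ℚ ≤ q ^ℚ k
^ℚ-nonNeg zero    _    = ℚP.nonNegative⁻¹ 1ℚ
^ℚ-nonNeg (suc k) 0≤q = *-nonNeg (0≤q (s≤s z≤n)) (^ℚ-nonNeg k (λ _ → 0≤q (s≤s z≤n)))

product : List ℚ → ℚ
product = foldr _*_ 1ℚ

product-∷ʳ : ∀ xs x → product (xs ∷ʳ x) ≡ product xs * x
product-∷ʳ []       x = trans (ℚP.*-identityʳ x) (≡.sym (ℚP.*-identityˡ x))
product-∷ʳ (y ∷ xs) x = trans (cong (y *_) (product-∷ʳ xs x)) (≡.sym (ℚP.*-assoc y _ x))

prodFromTo-empty : ∀ f {a b} → b ℕ.≤ a → prodFromTo f a b ≡ 1ℚ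
prodFromTo-empty f b≤a rewrite ℕP.m≤n⇒m∸n≡0 b≤a = refl

prodFromTo-snoc : ∀ f {a b} → a ℕ.≤ b → prodFromTo f a (suc b) ≡ prodFromTo f a b * f b
prodFromTo-snoc f {a} {b} a≤b = begin
  product (map g (upTo (suc b ℕ.∸ a)))    ≡⟨ cong (product ∘ map g ∘ upTo) (ℕP.+-∸-assoc 1 a≤b) ⟩
  product (map g (upTo (suc m)))           ≡⟨ cong (product ∘ map g) (≡.sym (ListP.upTo-∷ʳ m)) ⟩
  product (map g (upTo m ∷ʳ m))            ≡⟨ cong product (ListP.map-++ g (upTo m) (m ∷ [])) ⟩
  product (map g (upTo m) ∷ʳ g m)          ≡⟨ product-∷ʳ (map g (upTo m)) (g m) ⟩
  product (map g (upTo m)) * f (a ℕ.+ m)   ≡⟨ cong (λ t → product (map g (upTo m)) * f t) (ℕP.m+[n∸m]≡n a≤b) ⟩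
  prodFromTo f a b * f b                   ∎
  where
  open ≡-Reasoning
  g = λ k → f (a ℕ.+ k)
  m = b ℕ.∸ a

prodFromTo-nonNeg : ∀ f a b → (∀ t → a ℕ.≤ t → t ℕ.< b → 0ℚ ≤ f t) → 0ℚ ≤ prodFromTo f a b
prodFromTo-nonNeg f a zero    _   = subst (0ℚ ≤_) (≡.sym (prodFromTo-empty f {a} z≤n)) (ℚP.nonNegative⁻¹ 1ℚ)
prodFromTo-nonNeg f a (suc b) f≥0 with a ℕ.≤? b
... | yes a≤b = subst (0ℚ ≤_) (≡.sym (prodFromTo-snoc f a≤b))
  (*-nonNeg (prodFromTo-nonNeg f a b (λ t a≤t t<b → f≥0 t a≤t (ℕP.m<n⇒m<1+n t<b))) (f≥0 b a≤b ℕP.≤-refl))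
... | no  a≰b = subst (0ℚ ≤_) (≡.sym (prodFromTo-empty f {a} (ℕP.≰⇒> a≰b))) (ℚP.nonNegative⁻¹ 1ℚ)

prodFin-snoc : ∀ h (f : Fin (suc h) → ℚ) → prodFin (suc h) f ≡ prodFin h (f ∘ inject₁) * f (fromℕ h)
prodFin-snoc zero    f = trans (ℚP.*-identityʳ (f Fin.zero)) (≡.sym (ℚP.*-identityˡ (f Fin.zero)))
prodFin-snoc (suc h) f =
  trans (cong (f Fin.zero *_) (prodFin-snoc h (f ∘ Fin.suc))) (≡.sym (ℚP.*-assoc (f Fin.zero) _ _))

prodFin-nonNeg : ∀ h (f : Fin h → ℚ) → (∀ i → 0ℚ ≤ f i) → 0ℚ ≤ prodFin h f
prodFin-nonNeg zero    f f≥0 = ℚP.nonNegative⁻¹ 1ℚ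
prodFin-nonNeg (suc h) f f≥0 = *-nonNeg (f≥0 Fin.zero) (prodFin-nonNeg h (f ∘ Fin.suc) (f≥0 ∘ Fin.suc))

prodFin-mono-≤ : ∀ h {f g : Fin h → ℚ} → (∀ i → 0ℚ ≤ f i) → (∀ i → f i ≤ g i) → prodFin h f ≤ prodFin h g
prodFin-mono-≤ zero    f≥0 f≤g = ℚP.≤-refl
prodFin-mono-≤ (suc h) {f} {g} f≥0 f≤g = ℚP.≤-trans
  (*-monoˡ-≤′ (f≥0 Fin.zero) (prodFin-mono-≤ h (f≥0 ∘ Fin.suc) (f≤g ∘ Fin.suc)))
  (*-monoʳ-≤′ (prodFin-nonNeg h (g ∘ Fin.suc) (λ i → ℚP.≤-trans (f≥0 (Fin.suc i)) (f≤g (Fin.suc i))))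
               (f≤g Fin.zero))

prodFin-scale : ∀ h c (f : Fin h → ℚ) → prodFin h (λ i → c * f i) ≡ c ^ℚ h * prodFin h f
prodFin-scale zero    c f = refl
prodFin-scale (suc h) c f rewrite prodFin-scale h c (f ∘ Fin.suc) =
  solve 4 (λ c x p q → (c :* x) :* (p :* q) := (c :* p) :* (x :* q)) refl
    c (f Fin.zero) (c ^ℚ h) (prodFin h (f ∘ Fin.suc))
  where open +-*-Solver

∣p∪q∣≤∣p∣+∣q∣ : ∀ {n} (p q : Subset n) → ∣ p ∪ q ∣ ℕ.≤ ∣ p ∣ ℕ.+ ∣ q ∣
∣p∪q∣≤∣p∣+∣q∣ Vec.[]            Vec.[]            = z≤n
∣p∪q∣≤∣p∣+∣q∣ (outside Vec.∷ p) (outside Vec.∷ q) = ∣p∪q∣≤∣p∣+∣q∣ p q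
∣p∪q∣≤∣p∣+∣q∣ (outside Vec.∷ p) (inside  Vec.∷ q) =
  ℕP.≤-trans (s≤s (∣p∪q∣≤∣p∣+∣q∣ p q)) (ℕP.≤-reflexive (≡.sym (ℕP.+-suc ∣ p ∣ ∣ q ∣)))
∣p∪q∣≤∣p∣+∣q∣ (inside  Vec.∷ p) (outside Vec.∷ q) = s≤s (∣p∪q∣≤∣p∣+∣q∣ p q)
∣p∪q∣≤∣p∣+∣q∣ (inside  Vec.∷ p) (inside  Vec.∷ q) =
  s≤s (ℕP.≤-trans (∣p∪q∣≤∣p∣+∣q∣ p q) (ℕP.+-monoʳ-≤ ∣ p ∣ (ℕP.n≤1+n ∣ q ∣)))

∣⋃∣≤∑∣∣ : ∀ {n} m (B : Fin m → Subset n) → ∣ ⋃ (List.tabulate B) ∣ ℕ.≤ sum (λ i → ∣ B i ∣)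
∣⋃∣≤∑∣∣ {n} zero    B = ℕP.≤-reflexive (SubsetP.∣⊥∣≡0 n)
∣⋃∣≤∑∣∣     (suc m) B = ℕP.≤-trans (∣p∪q∣≤∣p∣+∣q∣ (B Fin.zero) _)
  (ℕP.+-monoʳ-≤ ∣ B Fin.zero ∣ (∣⋃∣≤∑∣∣ m (B ∘ Fin.suc)))

x∈⋃ : ∀ {n m} (B : Fin m → Subset n) i {x} → x ∈ B i → x ∈ ⋃ (List.tabulate B)
x∈⋃ B Fin.zero    x∈Bi = SubsetP.x∈p∪q⁺ (inj₁ x∈Bi)
x∈⋃ B (Fin.suc i) x∈Bi = SubsetP.x∈p∪q⁺ (inj₂ (x∈⋃ (B ∘ Fin.suc) i x∈Bi))

union-bound : ∀ {n m} (p q : Subset n) (B : Fin m → Subset n) →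
  (∀ {x} → x ∈ p → x ∈ q ⊎ ∃[ i ] x ∈ B i) → ∣ p ∣ ℕ.≤ ∣ q ∣ ℕ.+ sum (λ i → ∣ B i ∣)
union-bound {m = m} p q B cover = begin
  ∣ p ∣                               ≤⟨ SubsetP.p⊆q⇒∣p∣≤∣q∣ p⊆q∪⋃B ⟩
  ∣ q ∪ ⋃ (List.tabulate B) ∣         ≤⟨ ∣p∪q∣≤∣p∣+∣q∣ q _ ⟩
  ∣ q ∣ ℕ.+ ∣ ⋃ (List.tabulate B) ∣   ≤⟨ ℕP.+-monoʳ-≤ ∣ q ∣ (∣⋃∣≤∑∣∣ m B) ⟩
  ∣ q ∣ ℕ.+ sum (λ i → ∣ B i ∣)       ∎
  where
  open ℕP.≤-Reasoning
  p⊆q∪⋃B : p ⊆ q ∪ ⋃ (List.tabulate B)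
  p⊆q∪⋃B x∈p with cover x∈p
  ... | inj₁ x∈q       = SubsetP.x∈p∪q⁺ (inj₁ x∈q)
  ... | inj₂ (i , x∈B) = SubsetP.x∈p∪q⁺ (inj₂ (x∈⋃ B i x∈B))

subsetOf : ∀ {n} {P : Fin n → Set} → Decidable P → Subset n
subsetOf P? = Vec.tabulate (λ x → does (P? x))

∈-subsetOf⁺ : ∀ {n} {P : Fin n → Set} (P? : Decidable P) {x} → P x → x ∈ subsetOf P?
∈-subsetOf⁺ P? {x} px = VecP.lookup⇒[]= x _ (trans (VecP.lookup∘tabulate _ x) (dec-true (P? x) px))

∈-subsetOf⁻ : ∀ {n} {P : Fin n → Set} (P? : Decidable P) {x} → x ∈ subsetOf P? → P x
∈-subsetOf⁻ P? {x} x∈ with P? x | trans (≡.sym (VecP.lookup∘tabulate (λ y → does (P? y)) x)) (VecP.[]=⇒lookup x∈)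
... | yes px | _  = px
... | no  _  | ()

all-or-counterexample : ∀ {m} {P : Fin m → Set} → Decidable P → (∀ i → P i) ⊎ ∃[ i ] ¬ P i
all-or-counterexample {m} {P} P? with FinP.all? P?
... | yes all = inj₁ all
... | no  ¬all = inj₂ (FinP.¬∀⟶∃¬ m P P? ¬all)

nonempty⇒∣p∣>0 : ∀ {n} {p : Subset n} → Nonempty p → 0 ℕ.< ∣ p ∣
nonempty⇒∣p∣>0 (Fin.zero , Vec.here) = s≤s z≤n
nonempty⇒∣p∣>0 {p = s Vec.∷ p} (Fin.suc x , Vec.there x∈p) =
  ℕP.<-≤-trans (nonempty⇒∣p∣>0 (x , x∈p)) (SubsetP.∣p∣≤∣x∷p∣ s p)

∣p∣>0⇒nonempty : ∀ {n} {p : Subset n} → 0 ℕ.< ∣ p ∣ → Nonempty p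
∣p∣>0⇒nonempty {p = inside  Vec.∷ p} _      = Fin.zero , Vec.here
∣p∣>0⇒nonempty {p = outside Vec.∷ p} 0<∣p∣ = Product.map Fin.suc Vec.there (∣p∣>0⇒nonempty 0<∣p∣)

graphFor : ∀ {n} → Bool → Graph n → Graph n
graphFor true  G = G
graphFor false G = compl G

adj-∈-nbhd : ∀ {n} (G : Graph n) {x y} → y ∈ nbhd G x → adj G x y ≡ true
adj-∈-nbhd G {x} {y} y∈ = trans (≡.sym (VecP.lookup∘tabulate (adj G x) y)) (VecP.[]=⇒lookup y∈)

adj-compl : ∀ {n} (G : Graph n) x y → adj (compl G) x y ≡ true → adj G x y ≡ false
adj-compl G x y _ with adj G x y
adj-compl G x y () | true
adj-compl G x y _  | false = refl

adj-∈-nbhd-graphFor : ∀ {n} b (G : Graph n) {x y} → y ∈ nbhd (graphFor b G) x → adj G y x ≡ b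
adj-∈-nbhd-graphFor true  G {x} {y} y∈ = trans (Graph.sym G y x) (adj-∈-nbhd G y∈)
adj-∈-nbhd-graphFor false G {x} {y} y∈ = trans (Graph.sym G y x) (adj-compl G x y (adj-∈-nbhd (compl G) y∈))

Sparse-graphFor : ∀ {n} b (G : Graph n) e A B →
  Sparse (graphFor b G) e A B → if b then Sparse G e A B else Dense G e A B
Sparse-graphFor true  G e A B sparse = sparse
Sparse-graphFor false G e A B sparse = sparse

dropLast : ∀ {h} → Graph (suc h) → Graph h
dropLast H = record
  { adj    = λ i j → adj H (inject₁ i) (inject₁ j)
  ; sym    = λ i j → Graph.sym H (inject₁ i) (inject₁ j)
  ; irrefl = λ i → Graph.irrefl H (inject₁ i)
  }

data LastView : ∀ {h} → Fin (suc h) → Set where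
  last   : ∀ {h} → LastView (fromℕ h)
  inject : ∀ {h} (i : Fin h) → LastView (inject₁ i)

lastView : ∀ {h} (k : Fin (suc h)) → LastView k
lastView {zero}  Fin.zero    = last
lastView {suc h} Fin.zero    = inject Fin.zero
lastView {suc h} (Fin.suc k) with lastView k
... | last     = last
... | inject i = inject (Fin.suc i)

lookup-∷ʳ-inject₁ : ∀ {A : Set} {h} (φ : Vec A h) x i → lookup (φ Vec.∷ʳ x) (inject₁ i) ≡ lookup φ i
lookup-∷ʳ-inject₁ (y Vec.∷ φ) x Fin.zero    = refl
lookup-∷ʳ-inject₁ (y Vec.∷ φ) x (Fin.suc i) = lookup-∷ʳ-inject₁ φ x i

lookup-∷ʳ-fromℕ : ∀ {A : Set} {h} (φ : Vec A h) x → lookup (φ Vec.∷ʳ x) (fromℕ h) ≡ x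
lookup-∷ʳ-fromℕ Vec.[]       x = refl
lookup-∷ʳ-fromℕ (y Vec.∷ φ) x = lookup-∷ʳ-fromℕ φ x

IsCopyIn : ∀ {h n} → Graph h → Graph n → (Fin h → Subset n) → Vec (Fin n) h → Set
IsCopyIn H G D φ = IsCopy H G φ × (∀ i → lookup φ i ∈ D i)

module _ {h n} (φ : Vec (Fin n) h) (x : Fin n) where

  private
    at-inject : ∀ i → lookup (φ Vec.∷ʳ x) (inject₁ i) ≡ lookup φ i
    at-inject = lookup-∷ʳ-inject₁ φ x
    at-last : lookup (φ Vec.∷ʳ x) (fromℕ h) ≡ x
    at-last = lookup-∷ʳ-fromℕ φ x

  ∷ʳ-isCopy : ∀ {H : Graph (suc h)} {G : Graph n} → IsCopy (dropLast H) G φ → (∀ i → lookup φ i ≢ x) →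
    (∀ i → adj G (lookup φ i) x ≡ adj H (inject₁ i) (fromℕ h)) → IsCopy H G (φ Vec.∷ʳ x)
  ∷ʳ-isCopy {H} {G} (φ-injective , φ-adj) φ≢x x-adj = injective , adjacent
    where
    injective : ∀ k l → lookup (φ Vec.∷ʳ x) k ≡ lookup (φ Vec.∷ʳ x) l → k ≡ l
    injective k l eq with lastView k | lastView l
    ... | last     | last     = refl
    ... | inject i | inject j =
      cong inject₁ (φ-injective i j (trans (≡.sym (at-inject i)) (trans eq (at-inject j))))
    ... | inject i | last     = ⊥-elim (φ≢x i (trans (≡.sym (at-inject i)) (trans eq at-last)))
    ... | last     | inject j = ⊥-elim (φ≢x j (trans (≡.sym (at-inject j)) (trans (≡.sym eq) at-last)))

    adjacent : ∀ k l → adj G (lookup (φ Vec.∷ʳ x) k) (lookup (φ Vec.∷ʳ x) l) ≡ adj H k l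
    adjacent k l with lastView k | lastView l
    ... | last     | last     rewrite at-last = trans (Graph.irrefl G x) (≡.sym (Graph.irrefl H (fromℕ h)))
    ... | inject i | inject j rewrite at-inject i | at-inject j = φ-adj i j
    ... | inject i | last     rewrite at-inject i | at-last = x-adj i
    ... | last     | inject j rewrite at-inject j | at-last =
      trans (Graph.sym G x (lookup φ j)) (trans (x-adj j) (Graph.sym H (inject₁ j) (fromℕ h)))

  ∷ʳ-∈ : ∀ {D : Fin (suc h) → Subset n} → (∀ i → lookup φ i ∈ D (inject₁ i)) → x ∈ D (fromℕ h) →
    ∀ k → lookup (φ Vec.∷ʳ x) k ∈ D k
  ∷ʳ-∈ {D} φ∈D x∈D k with lastView k
  ... | last     = subst (_∈ D (fromℕ h)) (≡.sym at-last) x∈D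
  ... | inject i = subst (_∈ D (inject₁ i)) (≡.sym (at-inject i)) (φ∈D i)

concat-unique : ∀ {n} {A : Set} (key : A → Fin n) (M : Fin n → List A) →
  (∀ x → Unique (M x)) → (∀ x → All (λ a → key a ≡ x) (M x)) → Unique (concat (List.tabulate M))
concat-unique key M unique keyed = UniqueP.concat⁺ (AllP.tabulate⁺ unique) (AllPairsP.tabulate⁺ disjoint)
  where
  disjoint : ∀ {x y} → x ≢ y → Disjoint (M x) (M y)
  disjoint x≢y (a∈Mx , a∈My) = x≢y (trans (≡.sym (All.lookup (keyed _) a∈Mx)) (All.lookup (keyed _) a∈My))

length-concat-≥ : ∀ {n} {A : Set} (M : Fin n → List A) (p : Subset n) K →
  (∀ x → x ∈ p → K ≤ ℕ→ℚ (length (M x))) → K * ℕ→ℚ ∣ p ∣ ≤ ℕ→ℚ (length (concat (List.tabulate M)))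
length-concat-≥ M Vec.[] K _ = ℚP.≤-reflexive (ℚP.*-zeroʳ K)
length-concat-≥ M (b Vec.∷ p) K long = begin
  K * ℕ→ℚ ∣ b Vec.∷ p ∣                      ≤⟨ step b (long Fin.zero) ⟩
  ℕ→ℚ (length (M Fin.zero)) + ℕ→ℚ (length rest) ≡⟨ ≡.sym (ℕ→ℚ-+ (length (M Fin.zero)) (length rest)) ⟩
  ℕ→ℚ (length (M Fin.zero) ℕ.+ length rest)     ≡⟨ cong ℕ→ℚ (≡.sym (ListP.length-++ (M Fin.zero))) ⟩
  ℕ→ℚ (length (M Fin.zero ++ rest))             ∎
  where
  open ℚP.≤-Reasoning
  rest = concat (List.tabulate (M ∘ Fin.suc))
  IH : K * ℕ→ℚ ∣ p ∣ ≤ ℕ→ℚ (length rest)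
  IH = length-concat-≥ (M ∘ Fin.suc) p K (λ x x∈p → long (Fin.suc x) (Vec.there x∈p))
  step : ∀ b → (Fin.zero ∈ b Vec.∷ p → K ≤ ℕ→ℚ (length (M Fin.zero))) →
    K * ℕ→ℚ ∣ b Vec.∷ p ∣ ≤ ℕ→ℚ (length (M Fin.zero)) + ℕ→ℚ (length rest)
  step outside _ = ℚP.≤-trans IH (ℚP.≤-trans (ℚP.≤-reflexive (≡.sym (ℚP.+-identityˡ _)))
    (ℚP.+-monoˡ-≤ (ℕ→ℚ (length rest)) (ℕ→ℚ-nonNeg (length (M Fin.zero)))))
  step inside long₀ = begin
    K * ℕ→ℚ (suc ∣ p ∣)         ≡⟨ cong (K *_) (ℕ→ℚ-+ 1 ∣ p ∣) ⟩
    K * (1ℚ + ℕ→ℚ ∣ p ∣)        ≡⟨ ℚP.*-distribˡ-+ K 1ℚ (ℕ→ℚ ∣ p ∣) ⟩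
    K * 1ℚ + K * ℕ→ℚ ∣ p ∣      ≡⟨ cong (_+ K * ℕ→ℚ ∣ p ∣) (ℚP.*-identityʳ K) ⟩
    K + K * ℕ→ℚ ∣ p ∣           ≤⟨ ℚP.+-mono-≤ (long₀ Vec.here) IH ⟩
    ℕ→ℚ (length (M Fin.zero)) + ℕ→ℚ (length rest) ∎

sum-bounded : ∀ m (b : Fin m → ℕ) {k c} → (∀ i → k * ℕ→ℚ (b i) ≤ c) → k * ℕ→ℚ (sum b) ≤ ℕ→ℚ m * c
sum-bounded zero    b {k} {c} _ = ℚP.≤-reflexive (trans (ℚP.*-zeroʳ k) (≡.sym (ℚP.*-zeroˡ c)))
sum-bounded (suc m) b {k} {c} bounded = begin
  k * ℕ→ℚ (b Fin.zero ℕ.+ sum (b ∘ Fin.suc))          ≡⟨ cong (k *_) (ℕ→ℚ-+ (b Fin.zero) _) ⟩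
  k * (ℕ→ℚ (b Fin.zero) + ℕ→ℚ (sum (b ∘ Fin.suc)))    ≡⟨ ℚP.*-distribˡ-+ k _ _ ⟩
  k * ℕ→ℚ (b Fin.zero) + k * ℕ→ℚ (sum (b ∘ Fin.suc))
    ≤⟨ ℚP.+-mono-≤ (bounded Fin.zero) (sum-bounded m (b ∘ Fin.suc) {k} (bounded ∘ Fin.suc)) ⟩
  c + ℕ→ℚ m * c
    ≡⟨ solve 2 (λ c m → c :+ m :* c := (con 1ℚ :+ m) :* c) refl c (ℕ→ℚ m) ⟩
  (1ℚ + ℕ→ℚ m) * c                                    ≡⟨ cong (_* c) (≡.sym (ℕ→ℚ-+ 1 m)) ⟩
  ℕ→ℚ (suc m) * c                                     ∎
  where
  open ℚP.≤-Reasoning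
  open +-*-Solver

sum-≤-of-average : ∀ m (b : Fin (suc m) → ℕ) {c} → (∀ i → ℕ→ℚ (suc m) * ℕ→ℚ (b i) ≤ c) → ℕ→ℚ (sum b) ≤ c
sum-≤-of-average m b bounded =
  ℚP.*-cancelˡ-≤-pos (ℕ→ℚ (suc m)) {{positive (ℕ→ℚ-pos {suc m} (s≤s z≤n))}}
    (sum-bounded (suc m) b {k = ℕ→ℚ (suc m)} bounded)

fraction-remaining : ∀ {N S T δ} → N ≤ S + T → T ≤ δ * N → (1ℚ - δ) * N ≤ S
fraction-remaining {N} {S} {T} {δ} N≤S+T T≤δN = begin
  (1ℚ - δ) * N       ≡⟨ solve 2 (λ δ N → (con 1ℚ :- δ) :* N := N :- δ :* N) refl δ N ⟩
  N - δ * N          ≤⟨ ℚP.+-monoˡ-≤ (- (δ * N)) N≤S+T ⟩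
  (S + T) - δ * N    ≤⟨ ℚP.+-monoˡ-≤ (- (δ * N)) (ℚP.+-monoʳ-≤ S T≤δN) ⟩
  (S + δ * N) - δ * N ≡⟨ solve 2 (λ S e → (S :+ e) :- e := S) refl S (δ * N) ⟩
  S                  ∎
  where
  open ℚP.≤-Reasoning
  open +-*-Solver

-- With a single part every vertex is good: the bound has no factor 1 - δ₀.
goodFraction : (ℕ → ℚ) → ℕ → ℚ
goodFraction δ zero    = 1ℚ
goodFraction δ (suc t) = 1ℚ - δ (suc t)

goodFraction-≤ : ∀ m δ {N S} (b : Fin m → ℕ) → N ≤ S + ℕ→ℚ (sum b) →
  (∀ i → ℕ→ℚ m * ℕ→ℚ (b i) ≤ δ m * N) → goodFraction δ m * N ≤ S
goodFraction-≤ zero    δ {N} {S} b N≤S _ =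
  subst₂ _≤_ (≡.sym (ℚP.*-identityˡ N)) (ℚP.+-identityʳ S) N≤S
goodFraction-≤ (suc m) δ       b N≤S+∑b bounded =
  fraction-remaining {δ = δ (suc m)} N≤S+∑b (sum-≤-of-average m b bounded)

weight : (ε δ : ℕ → ℚ) → ℕ → ℚ
weight ε δ h = prodFromTo (λ t → (1ℚ - δ t) * (ε t ^ℚ t)) 1 h

weight-suc : ∀ ε δ h → weight ε δ (suc h) ≡ weight ε δ h * (goodFraction δ h * ε h ^ℚ h)
weight-suc ε δ zero    = refl
weight-suc ε δ (suc h) = prodFromTo-snoc (λ t → (1ℚ - δ t) * (ε t ^ℚ t)) {1} {suc h} (s≤s z≤n)

volume : ∀ {h n} → (Fin h → Subset n) → ℚ
volume {h} D = prodFin h (λ i → ℕ→ℚ ∣ D i ∣)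

volume-nonNeg : ∀ {h n} (D : Fin h → Subset n) → 0ℚ ≤ volume D
volume-nonNeg {h} D = prodFin-nonNeg h _ (λ i → ℕ→ℚ-nonNeg ∣ D i ∣)

PairwiseDisjoint : ∀ {h n} → (Fin h → Subset n) → Set
PairwiseDisjoint D = ∀ i j → i ≢ j → Empty (D i ∩ D j)

-- t = toℕ j is the paper's j - 1 for the pair of parts (D_i, D_j), and h is the number of parts.
IrregularPair : ∀ {n} → Bool → Graph n → (ε δ : ℕ → ℚ) → Subset n → Subset n → ℕ → ℕ → Set
IrregularPair b G ε δ P Q t h = ∃[ A ] ∃[ B ] (A ⊆ P × B ⊆ Q
  × prodFromTo ε (suc t) h * ℕ→ℚ ∣ P ∣ ≤ ℕ→ℚ ∣ A ∣
  × δ t * prodFromTo ε (suc t) h * ℕ→ℚ ∣ Q ∣ ≤ ℕ→ℚ t * ℕ→ℚ ∣ B ∣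
  × (if b then Sparse G (ε t) A B else Dense G (ε t) A B))

NoIrregularPair : ∀ {h n} → Graph h → Graph n → (ε δ : ℕ → ℚ) → (Fin h → Subset n) → Set
NoIrregularPair {h} H G ε δ D =
  ∀ (i j : Fin h) → toℕ i ℕ.< toℕ j → ¬ IrregularPair (adj H i j) G ε δ (D i) (D j) (toℕ j) h

ManyCopies : ∀ {h n} → ℚ → Graph h → Graph n → (Fin h → Subset n) → Set
ManyCopies {h} {n} c H G D =
  ∃[ L ] (Unique {A = Vec (Fin n) h} L × All (IsCopyIn H G D) L × c ≤ ℕ→ℚ (length L))

IrregularPair-lift : ∀ {n} b (G : Graph n) ε δ {P Q P′ Q′ : Subset n} {t h} → t ℕ.< h →
  0ℚ ≤ prodFromTo ε (suc t) h → 0ℚ ≤ δ t → P′ ⊆ P → Q′ ⊆ Q →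
  ε h * ℕ→ℚ ∣ P ∣ ≤ ℕ→ℚ ∣ P′ ∣ → ε h * ℕ→ℚ ∣ Q ∣ ≤ ℕ→ℚ ∣ Q′ ∣ →
  IrregularPair b G ε δ P′ Q′ t h → IrregularPair b G ε δ P Q t (suc h)
IrregularPair-lift b G ε δ {P} {Q} {t = t} {h} t<h 0≤Π 0≤δ P′⊆P Q′⊆Q P′-large Q′-large
  (A , B , A⊆P′ , B⊆Q′ , A-large , B-large , skewed) =
  A , B , P′⊆P ∘ A⊆P′ , Q′⊆Q ∘ B⊆Q′ , A-large′ , B-large′ , skewed
  where
  open +-*-Solver
  Π = prodFromTo ε (suc t) h
  Π-suc : prodFromTo ε (suc t) (suc h) ≡ Π * ε h
  Π-suc = prodFromTo-snoc ε t<h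
  A-large′ : prodFromTo ε (suc t) (suc h) * ℕ→ℚ ∣ P ∣ ≤ ℕ→ℚ ∣ A ∣
  A-large′ = subst (_≤ ℕ→ℚ ∣ A ∣)
    (trans (≡.sym (ℚP.*-assoc Π (ε h) (ℕ→ℚ ∣ P ∣))) (cong (_* ℕ→ℚ ∣ P ∣) (≡.sym Π-suc)))
    (ℚP.≤-trans (*-monoˡ-≤′ 0≤Π P′-large) A-large)
  B-large′ : δ t * prodFromTo ε (suc t) (suc h) * ℕ→ℚ ∣ Q ∣ ≤ ℕ→ℚ t * ℕ→ℚ ∣ B ∣
  B-large′ = subst (_≤ ℕ→ℚ t * ℕ→ℚ ∣ B ∣)
    (trans (solve 4 (λ d p e q → (d :* p) :* (e :* q) := (d :* (p :* e)) :* q) refl (δ t) Π (ε h) (ℕ→ℚ ∣ Q ∣))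
           (cong (λ π → δ t * π * ℕ→ℚ ∣ Q ∣) (≡.sym Π-suc)))
    (ℚP.≤-trans (*-monoˡ-≤′ (*-nonNeg 0≤δ 0≤Π) Q′-large) B-large)

module InductionStep {h n} (H : Graph (suc h)) (ε δ : ℕ → ℚ)
  (bounds : ∀ t → 1 ℕ.≤ t → t ℕ.< suc h → (0ℚ < ε t × ε t < 1ℚ) × (0ℚ < δ t × δ t < 1ℚ))
  (G : Graph n) (D : Fin (suc h) → Subset n)
  (disjoint : PairwiseDisjoint D) (nonempty : ∀ i → Nonempty (D i)) (regular : NoIrregularPair H G ε δ D)
  (copies-of-dropLast : ∀ D′ → PairwiseDisjoint D′ → (∀ i → Nonempty (D′ i)) →
     NoIrregularPair (dropLast H) G ε δ D′ → ManyCopies (weight ε δ h * volume D′) (dropLast H) G D′)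
  where

  ε-pos : ∀ {t} → 1 ℕ.≤ t → t ℕ.≤ h → 0ℚ < ε t
  ε-pos {t} 1≤t t≤h = proj₁ (proj₁ (bounds t 1≤t (s≤s t≤h)))

  εₕ-pos : Fin h → 0ℚ < ε h
  εₕ-pos i = ε-pos (ℕP.<-≤-trans (s≤s z≤n) (FinP.toℕ<n i)) ℕP.≤-refl

  lastPart : Subset n
  lastPart = D (fromℕ h)

  -- t is kept free so that toℕ (fromℕ h) and toℕ (inject₁ j) can be traded for h and toℕ j.
  regular-at : ∀ i j {t} → toℕ j ≡ t → toℕ i ℕ.< t → ¬ IrregularPair (adj H i j) G ε δ (D i) (D j) t (suc h)
  regular-at i j refl = regular i j

  link : Fin n → Fin h → Subset n
  link x i = D (inject₁ i) ∩ nbhd (graphFor (adj H (inject₁ i) (fromℕ h)) G) x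

  LargeLink : Fin n → Fin h → Set
  LargeLink x i = ε h * ℕ→ℚ ∣ D (inject₁ i) ∣ ≤ ℕ→ℚ ∣ link x i ∣

  Good : Fin n → Set
  Good x = x ∈ lastPart × (∀ i → LargeLink x i)

  Bad : Fin h → Fin n → Set
  Bad i x = x ∈ lastPart × ¬ LargeLink x i

  largeLink? : ∀ x i → Dec (LargeLink x i)
  largeLink? x i = ε h * ℕ→ℚ ∣ D (inject₁ i) ∣ ℚP.≤? ℕ→ℚ ∣ link x i ∣

  good? : Decidable Good
  good? x = (x SubsetP.∈? lastPart) ×-dec FinP.all? (largeLink? x)

  bad? : ∀ i → Decidable (Bad i)
  bad? i x = (x SubsetP.∈? lastPart) ×-dec ¬? (largeLink? x i)

  bad-small : ∀ i → ℕ→ℚ h * ℕ→ℚ ∣ subsetOf (bad? i) ∣ ≤ δ h * ℕ→ℚ ∣ lastPart ∣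
  bad-small i = ℚP.<⇒≤ (ℚP.≰⇒> λ many-bad →
    regular-at (inject₁ i) (fromℕ h) (FinP.toℕ-fromℕ h) (FinP.inject₁ℕ< i)
      (A , subsetOf (bad? i) , (λ a → a) , proj₁ ∘ ∈-subsetOf⁻ (bad? i) , A-large , B-large many-bad ,
       Sparse-graphFor _ G (ε h) A _ (λ b b∈ → ℚP.≰⇒> (proj₂ (∈-subsetOf⁻ (bad? i) b∈)))))
    where
    A = D (inject₁ i)
    A-large : prodFromTo ε (suc h) (suc h) * ℕ→ℚ ∣ A ∣ ≤ ℕ→ℚ ∣ A ∣
    A-large = ℚP.≤-reflexive
      (trans (cong (_* ℕ→ℚ ∣ A ∣) (prodFromTo-empty ε {suc h} ℕP.≤-refl)) (ℚP.*-identityˡ _))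
    B-large : δ h * ℕ→ℚ ∣ lastPart ∣ ≤ ℕ→ℚ h * ℕ→ℚ ∣ subsetOf (bad? i) ∣ →
      δ h * prodFromTo ε (suc h) (suc h) * ℕ→ℚ ∣ lastPart ∣ ≤ ℕ→ℚ h * ℕ→ℚ ∣ subsetOf (bad? i) ∣
    B-large = subst (λ π → δ h * π * ℕ→ℚ ∣ lastPart ∣ ≤ ℕ→ℚ h * ℕ→ℚ ∣ subsetOf (bad? i) ∣)
                (≡.sym (prodFromTo-empty ε {suc h} ℕP.≤-refl))
            ∘ subst (λ c → c * ℕ→ℚ ∣ lastPart ∣ ≤ ℕ→ℚ h * ℕ→ℚ ∣ subsetOf (bad? i) ∣)
                (≡.sym (ℚP.*-identityʳ (δ h)))

  many-good : goodFraction δ h * ℕ→ℚ ∣ lastPart ∣ ≤ ℕ→ℚ ∣ subsetOf good? ∣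
  many-good = goodFraction-≤ h δ {N = ℕ→ℚ ∣ lastPart ∣} {S = ℕ→ℚ ∣ subsetOf good? ∣}
    (λ i → ∣ subsetOf (bad? i) ∣)
    (subst (ℕ→ℚ ∣ lastPart ∣ ≤_) (ℕ→ℚ-+ ∣ subsetOf good? ∣ ∑bad)
      (ℕ→ℚ-mono-≤ {∣ lastPart ∣} {∣ subsetOf good? ∣ ℕ.+ ∑bad}
        (union-bound lastPart (subsetOf good?) (λ i → subsetOf (bad? i)) good-or-bad)))
    bad-small
    where
    ∑bad = sum (λ i → ∣ subsetOf (bad? i) ∣)
    good-or-bad : ∀ {x} → x ∈ lastPart → x ∈ subsetOf good? ⊎ ∃[ i ] x ∈ subsetOf (bad? i)
    good-or-bad {x} x∈ = Sum.map (λ large → ∈-subsetOf⁺ good? (x∈ , large))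
      (Product.map₂ (λ {i} small → ∈-subsetOf⁺ (bad? i) (x∈ , small))) (all-or-counterexample (largeLink? x))

  module _ {x} (good : Good x) where

    link-disjoint : PairwiseDisjoint (link x)
    link-disjoint i j i≢j (y , y∈) with SubsetP.x∈p∩q⁻ (link x i) (link x j) y∈
    ... | y∈i , y∈j = disjoint (inject₁ i) (inject₁ j) (i≢j ∘ FinP.inject₁-injective)
      (y , SubsetP.x∈p∩q⁺ (SubsetP.p∩q⊆p _ _ y∈i , SubsetP.p∩q⊆p _ _ y∈j))

    link-nonempty : ∀ i → Nonempty (link x i)
    link-nonempty i = ∣p∣>0⇒nonempty (ℕ→ℚ-pos⇒pos _ (ℚP.<-≤-trans
      (*-pos (εₕ-pos i) (ℕ→ℚ-pos (nonempty⇒∣p∣>0 (nonempty (inject₁ i))))) (proj₂ good i)))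

    link-regular : NoIrregularPair (dropLast H) G ε δ (link x)
    link-regular i j i<j irregular =
      regular-at (inject₁ i) (inject₁ j) (FinP.toℕ-inject₁ j)
        (subst (ℕ._< toℕ j) (≡.sym (FinP.toℕ-inject₁ i)) i<j)
        (IrregularPair-lift _ G ε δ (FinP.toℕ<n j) Π-nonNeg δ-nonNeg (SubsetP.p∩q⊆p _ _) (SubsetP.p∩q⊆p _ _)
          (proj₂ good i) (proj₂ good j) irregular)
      where
      1≤j : 1 ℕ.≤ toℕ j
      1≤j = ℕP.<-≤-trans (s≤s z≤n) i<j
      Π-nonNeg : 0ℚ ≤ prodFromTo ε (suc (toℕ j)) h
      Π-nonNeg = prodFromTo-nonNeg ε (suc (toℕ j)) h λ t j<t t<h →
        ℚP.<⇒≤ (ε-pos (ℕP.≤-trans 1≤j (ℕP.<⇒≤ j<t)) (ℕP.<⇒≤ t<h))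
      δ-nonNeg : 0ℚ ≤ δ (toℕ j)
      δ-nonNeg = ℚP.<⇒≤ (proj₁ (proj₂ (bounds (toℕ j) 1≤j (ℕP.m<n⇒m<1+n (FinP.toℕ<n j)))))

    link-volume : ε h ^ℚ h * volume (D ∘ inject₁) ≤ volume (link x)
    link-volume = subst (_≤ volume (link x)) (prodFin-scale h (ε h) (λ i → ℕ→ℚ ∣ D (inject₁ i) ∣))
      (prodFin-mono-≤ h (λ i → *-nonNeg (ℚP.<⇒≤ (εₕ-pos i)) (ℕ→ℚ-nonNeg ∣ D (inject₁ i) ∣)) (proj₂ good))

  weight-nonNeg : 0ℚ ≤ weight ε δ h
  weight-nonNeg = prodFromTo-nonNeg (λ t → (1ℚ - δ t) * (ε t ^ℚ t)) 1 h λ t 1≤t t<h →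
    *-nonNeg (1-p-nonNeg (proj₂ (proj₂ (bounds t 1≤t (ℕP.m<n⇒m<1+n t<h)))))
             (^ℚ-nonNeg t (λ _ → ℚP.<⇒≤ (ε-pos 1≤t (ℕP.<⇒≤ t<h))))

  copiesPerGoodVertex : ℚ
  copiesPerGoodVertex = weight ε δ h * (ε h ^ℚ h * volume (D ∘ inject₁))

  copiesPerGoodVertex-nonNeg : 0ℚ ≤ copiesPerGoodVertex
  copiesPerGoodVertex-nonNeg = *-nonNeg weight-nonNeg
    (*-nonNeg (^ℚ-nonNeg h (λ 1≤h → ℚP.<⇒≤ (ε-pos 1≤h ℕP.≤-refl))) (volume-nonNeg (D ∘ inject₁)))

  CopiesEndingAt : Fin n → List (Vec (Fin n) (suc h)) → Set
  CopiesEndingAt x M = Unique M × All (λ ψ → lookup ψ (fromℕ h) ≡ x) M × All (IsCopyIn H G D) M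

  copies-through : ∀ {x} → Good x → Σ[ M ∈ List (Vec (Fin n) (suc h)) ]
    (CopiesEndingAt x M × copiesPerGoodVertex ≤ ℕ→ℚ (length M))
  copies-through {x} good@(x∈last , _) =
    map (Vec._∷ʳ x) L ,
    (UniqueP.map⁺ (VecP.∷ʳ-injectiveˡ _ _) unique ,
     AllP.map⁺ (All.universal (λ φ → lookup-∷ʳ-fromℕ φ x) L) ,
     AllP.map⁺ (All.map (λ {φ} → extend φ) copies)) ,
    subst (copiesPerGoodVertex ≤_) (cong ℕ→ℚ (≡.sym (ListP.length-map (Vec._∷ʳ x) L)))
      (ℚP.≤-trans (*-monoˡ-≤′ weight-nonNeg (link-volume good)) many)
    where
    link-copies = copies-of-dropLast (link x) (link-disjoint good) (link-nonempty good) (link-regular good)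
    L = proj₁ link-copies
    unique = proj₁ (proj₂ link-copies)
    copies = proj₁ (proj₂ (proj₂ link-copies))
    many = proj₂ (proj₂ (proj₂ link-copies))
    extend : ∀ φ → IsCopyIn (dropLast H) G (link x) φ → IsCopyIn H G D (φ Vec.∷ʳ x)
    extend φ (copy , φ∈link) =
      ∷ʳ-isCopy φ x {H} {G} copy φ≢x
        (λ i → adj-∈-nbhd-graphFor (adj H (inject₁ i) (fromℕ h)) G (SubsetP.p∩q⊆q _ _ (φ∈link i))) ,
      ∷ʳ-∈ φ x φ∈D x∈last
      where
      φ∈D : ∀ i → lookup φ i ∈ D (inject₁ i)
      φ∈D i = SubsetP.p∩q⊆p _ _ (φ∈link i)
      φ≢x : ∀ i → lookup φ i ≢ x
      φ≢x i φi≡x = disjoint (inject₁ i) (fromℕ h) (FinP.fromℕ≢inject₁ ∘ ≡.sym)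
        (x , SubsetP.x∈p∩q⁺ (subst (_∈ D (inject₁ i)) φi≡x (φ∈D i) , x∈last))

  copies-at : ∀ x → Σ[ M ∈ List (Vec (Fin n) (suc h)) ]
    (CopiesEndingAt x M × (x ∈ subsetOf good? → copiesPerGoodVertex ≤ ℕ→ℚ (length M)))
  copies-at x = decide (good? x)
    where
    decide : Dec (Good x) → Σ[ M ∈ List (Vec (Fin n) (suc h)) ]
      (CopiesEndingAt x M × (x ∈ subsetOf good? → copiesPerGoodVertex ≤ ℕ→ℚ (length M)))
    decide (yes good) = let M , copies , many = copies-through good in M , copies , λ _ → many
    decide (no ¬good) = [] , (AllPairs.[] , All.[] , All.[]) , λ x∈ → ⊥-elim (¬good (∈-subsetOf⁻ good? x∈))

  many-copies : ManyCopies (weight ε δ (suc h) * volume D) H G D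
  many-copies =
    concat (List.tabulate M) ,
    concat-unique (λ ψ → lookup ψ (fromℕ h)) M (proj₁ ∘ copies) (proj₁ ∘ proj₂ ∘ copies) ,
    AllP.concat⁺ (AllP.tabulate⁺ (proj₂ ∘ proj₂ ∘ copies)) ,
    bound
    where
    M : Fin n → List (Vec (Fin n) (suc h))
    M x = proj₁ (copies-at x)
    copies : ∀ x → CopiesEndingAt x (M x)
    copies x = proj₁ (proj₂ (copies-at x))
    N = ℕ→ℚ ∣ lastPart ∣
    open ℚP.≤-Reasoning
    open +-*-Solver
    bound : weight ε δ (suc h) * volume D ≤ ℕ→ℚ (length (concat (List.tabulate M)))
    bound = begin
      weight ε δ (suc h) * volume D
        ≡⟨ cong₂ _*_ (weight-suc ε δ h) (prodFin-snoc h (λ i → ℕ→ℚ ∣ D i ∣)) ⟩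
      weight ε δ h * (goodFraction δ h * ε h ^ℚ h) * (volume (D ∘ inject₁) * N)
        ≡⟨ solve 5 (λ w g e v N → w :* (g :* e) :* (v :* N) := w :* (e :* v) :* (g :* N)) refl
             (weight ε δ h) (goodFraction δ h) (ε h ^ℚ h) (volume (D ∘ inject₁)) N ⟩
      copiesPerGoodVertex * (goodFraction δ h * N)
        ≤⟨ *-monoˡ-≤′ copiesPerGoodVertex-nonNeg many-good ⟩
      copiesPerGoodVertex * ℕ→ℚ ∣ subsetOf good? ∣
        ≤⟨ length-concat-≥ M (subsetOf good?) copiesPerGoodVertex (λ x → proj₂ (proj₂ (copies-at x))) ⟩
      ℕ→ℚ (length (concat (List.tabulate M))) ∎

lemma2p1 : (h : ℕ) (H : Graph h) (ε δ : ℕ → ℚ)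
  → (∀ t → 1 Data.Nat.≤ t → t Data.Nat.< h → (0ℚ < ε t × ε t < 1ℚ) × (0ℚ < δ t × δ t < 1ℚ))
  → (n : ℕ) (G : Graph n) (D : Fin h → Subset n)
  → (∀ i j → i ≢ j → Empty (D i ∩ D j))
  → (∀ i → Nonempty (D i))
  → (∀ (i j : Fin h) → toℕ i Data.Nat.< toℕ j →
       ¬ (∃[ A ] ∃[ B ] (A ⊆ D i × B ⊆ D j
           × prodFromTo ε (suc (toℕ j)) h * ℕ→ℚ ∣ D i ∣ ≤ ℕ→ℚ ∣ A ∣
           × δ (toℕ j) * prodFromTo ε (suc (toℕ j)) h * ℕ→ℚ ∣ D j ∣ ≤ ℕ→ℚ (toℕ j) * ℕ→ℚ ∣ B ∣
           × (if adj H i j then Sparse G (ε (toℕ j)) A B else Dense G (ε (toℕ j)) A B))))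
  → ∃[ L ] (Unique L
       × All (λ (φ : Vec (Fin n) h) → IsCopy H G φ × (∀ i → lookup φ i ∈ D i)) L
       × prodFromTo (λ t → (1ℚ - δ t) * (ε t ^ℚ t)) 1 h * prodFin h (λ i → ℕ→ℚ ∣ D i ∣)
           ≤ ℕ→ℚ (length L))
lemma2p1 zero H ε δ _ n G D _ _ _ =
  Vec.[] ∷ [] , All.[] AllPairs.∷ AllPairs.[] , ((((λ ()) , (λ ())) , (λ ())) All.∷ All.[]) , ℚP.≤-refl
lemma2p1 (suc h) H ε δ bounds n G D disjoint nonempty regular =
  InductionStep.many-copies H ε δ bounds G D disjoint nonempty regular
    (lemma2p1 h (dropLast H) ε δ (λ t 1≤t t<h → bounds t 1≤t (ℕP.m<n⇒m<1+n t<h)) n G)
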